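{- Let $A$ be a residuated lattice. Then (i) $Ds(A/F)=Ds(A)/F$ for every filter $F$ of $A$ with $F\subseteq Ds(A)$, where $Ds(A)/F=\{a/F\mid a\in Ds(A)\}$; (ii) $Ds(B)=B\cap Ds(A)$ for every subalgebra $B$ of $A$; (iii) $Ds\left(\prod_{i\in I}A_i\right)=\prod_{i\in I}Ds(A_i)$ for every family $\{A_i\mid i\in I\}$ of residuated lattices.
   Context: A residuated lattice is a commutative integral residuated bounded lattice $(A,\vee,\wedge,\odot,\rightarrow,0,1)$ (bounded lattice, commutative monoid $(A,\odot,1)$, $a\le b\rightarrow c$ iff $a\odot b\le c$); $\neg a:=a\rightarrow 0$. $Ds(A)=\{a\in A\mid\neg a=0\}$ (dense elements). A filter is a nonempty subset closed under $\odot$ and upward closed; $A/F$ is the quotient by the congruence $a\equiv b$ iff $(a\rightarrow b)\wedge(b\rightarrow a)\in F$, with classes $a/F$. -}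

module Defs where

open import Level using (Level; _⊔_) renaming (suc to lsuc)
open import Algebra.Core using (Op₂)
open import Algebra.Structures using (IsCommutativeMonoid; IsMonoid; IsSemigroup; IsMagma)
open import Algebra.Lattice.Structures using (IsLattice)
open import Relation.Binary.Core using (Rel)
open import Relation.Binary.Structures using (IsEquivalence)
open import Relation.Unary using (Pred; _∈_)
open import Data.Product using (Σ; ∃; _×_; _,_; proj₁; proj₂)

-- A residuated lattice (commutative, integral, bounded), on a setoid carrier.
-- The order is the lattice order  a ≤ b  :⇔  a ∧ b ≈ a.
record ResiduatedLattice (c ℓ : Level) : Set (lsuc (c ⊔ ℓ)) where
  infix  4 _≈_
  infixr 5 _⇒_
  infixl 6 _⊙_
  infixr 7 _∨_
  infixr 8 _∧_
  field
    Carrier   : Set c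
    _≈_       : Rel Carrier ℓ
    _∨_       : Op₂ Carrier
    _∧_       : Op₂ Carrier
    _⊙_       : Op₂ Carrier
    _⇒_       : Op₂ Carrier
    0#        : Carrier
    1#        : Carrier
    isLattice : IsLattice _≈_ _∨_ _∧_
    ⊙-isCommutativeMonoid : IsCommutativeMonoid _≈_ _⊙_ 1#
    ⇒-cong    : ∀ {a a′ b b′} → a ≈ a′ → b ≈ b′ → (a ⇒ b) ≈ (a′ ⇒ b′)
    0-least   : ∀ a → (0# ∧ a) ≈ 0#
    1-greatest : ∀ a → (a ∧ 1#) ≈ a
    residuation-→ : ∀ a b c → (a ∧ (b ⇒ c)) ≈ a → ((a ⊙ b) ∧ c) ≈ (a ⊙ b)
    residuation-← : ∀ a b c → ((a ⊙ b) ∧ c) ≈ (a ⊙ b) → (a ∧ (b ⇒ c)) ≈ a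

  infix 4 _≤_
  _≤_ : Rel Carrier ℓ
  a ≤ b = (a ∧ b) ≈ a

  ¬_ : Carrier → Carrier
  ¬ a = a ⇒ 0#

Ds : ∀ {c ℓ} (A : ResiduatedLattice c ℓ) → Pred (ResiduatedLattice.Carrier A) ℓ
Ds A a = (¬ a) ≈ 0#
  where open ResiduatedLattice A

record IsFilter {c ℓ f} (A : ResiduatedLattice c ℓ) (F : Pred (ResiduatedLattice.Carrier A) f)
       : Set (c ⊔ ℓ ⊔ f) where
  open ResiduatedLattice A
  field
    nonempty : ∃ λ a → a ∈ F
    ⊙-closed : ∀ {a b} → a ∈ F → b ∈ F → (a ⊙ b) ∈ F
    up-closed : ∀ {a b} → a ∈ F → a ≤ b → b ∈ F

-- The congruence of the quotient A/F:  a ≡_F b  iff  (a → b) ∧ (b → a) ∈ F.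
-- Equality of classes a/F = b/F is exactly a ≡_F b.
_≡[_]_ : ∀ {c ℓ f} {A : ResiduatedLattice c ℓ} →
         ResiduatedLattice.Carrier A → Pred (ResiduatedLattice.Carrier A) f →
         ResiduatedLattice.Carrier A → Set f
_≡[_]_ {A = A} a F b = ((a ⇒ b) ∧ (b ⇒ a)) ∈ F
  where open ResiduatedLattice A

-- Ds(A/F), as a set of representatives: the class a/F is dense in A/F iff
-- ¬_{A/F}(a/F) = 0/F, i.e. (¬a)/F = 0/F, i.e. ¬a ≡_F 0.
DsQuot : ∀ {c ℓ f} (A : ResiduatedLattice c ℓ) (F : Pred (ResiduatedLattice.Carrier A) f) →
         Pred (ResiduatedLattice.Carrier A) f
DsQuot A F a = _≡[_]_ {A = A} (¬ a) F 0#
  where open ResiduatedLattice A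

-- Ds(A)/F = { a/F | a ∈ Ds(A) }, as a set of representatives:
-- x/F belongs to it iff x/F = a/F for some dense a.
DsModF : ∀ {c ℓ f} (A : ResiduatedLattice c ℓ) (F : Pred (ResiduatedLattice.Carrier A) f) →
         Pred (ResiduatedLattice.Carrier A) (c ⊔ ℓ ⊔ f)
DsModF A F x = ∃ λ a → Ds A a × _≡[_]_ {A = A} x F a

record IsSubalgebra {c ℓ b} (A : ResiduatedLattice c ℓ) (B : Pred (ResiduatedLattice.Carrier A) b)
       : Set (c ⊔ b) where
  open ResiduatedLattice A
  field
    0∈ : 0# ∈ B
    1∈ : 1# ∈ B
    ∨-closed : ∀ {x y} → x ∈ B → y ∈ B → (x ∨ y) ∈ B
    ∧-closed : ∀ {x y} → x ∈ B → y ∈ B → (x ∧ y) ∈ B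
    ⊙-closed : ∀ {x y} → x ∈ B → y ∈ B → (x ⊙ y) ∈ B
    ⇒-closed : ∀ {x y} → x ∈ B → y ∈ B → (x ⇒ y) ∈ B

SubRL : ∀ {c ℓ b} (A : ResiduatedLattice c ℓ) (B : Pred (ResiduatedLattice.Carrier A) b) →
        IsSubalgebra A B → ResiduatedLattice (c ⊔ b) ℓ
SubRL A B S = record
  { Carrier = Σ Carrier B
  ; _≈_ = λ x y → proj₁ x ≈ proj₁ y
  ; _∨_ = λ x y → (proj₁ x ∨ proj₁ y) , ∨-closed (proj₂ x) (proj₂ y)
  ; _∧_ = λ x y → (proj₁ x ∧ proj₁ y) , ∧-closed (proj₂ x) (proj₂ y)
  ; _⊙_ = λ x y → (proj₁ x ⊙ proj₁ y) , ⊙-closed (proj₂ x) (proj₂ y)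
  ; _⇒_ = λ x y → (proj₁ x ⇒ proj₁ y) , ⇒-closed (proj₂ x) (proj₂ y)
  ; 0# = 0# , 0∈
  ; 1# = 1# , 1∈
  ; isLattice = record
    { isEquivalence = record { refl = L.refl ; sym = L.sym ; trans = L.trans }
    ; ∨-comm = λ x y → L.∨-comm (proj₁ x) (proj₁ y)
    ; ∨-assoc = λ x y z → L.∨-assoc (proj₁ x) (proj₁ y) (proj₁ z)
    ; ∨-cong = L.∨-cong
    ; ∧-comm = λ x y → L.∧-comm (proj₁ x) (proj₁ y)
    ; ∧-assoc = λ x y z → L.∧-assoc (proj₁ x) (proj₁ y) (proj₁ z)
    ; ∧-cong = L.∧-cong
    ; absorptive = (λ x y → proj₁ L.absorptive (proj₁ x) (proj₁ y))
                 , (λ x y → proj₂ L.absorptive (proj₁ x) (proj₁ y))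
    }
  ; ⊙-isCommutativeMonoid = record
    { isMonoid = record
      { isSemigroup = record
        { isMagma = record
          { isEquivalence = record { refl = L.refl ; sym = L.sym ; trans = L.trans }
          ; ∙-cong = M.∙-cong }
        ; assoc = λ x y z → M.assoc (proj₁ x) (proj₁ y) (proj₁ z) }
      ; identity = (λ x → proj₁ M.identity (proj₁ x)) , (λ x → proj₂ M.identity (proj₁ x)) }
    ; comm = λ x y → M.comm (proj₁ x) (proj₁ y) }
  ; ⇒-cong = ⇒-cong
  ; 0-least = λ a → 0-least (proj₁ a)
  ; 1-greatest = λ a → 1-greatest (proj₁ a)
  ; residuation-→ = λ a b c → residuation-→ (proj₁ a) (proj₁ b) (proj₁ c)
  ; residuation-← = λ a b c → residuation-← (proj₁ a) (proj₁ b) (proj₁ c)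
  }
  where
  open ResiduatedLattice A
  open IsSubalgebra S
  module L = IsLattice isLattice
  module M = IsCommutativeMonoid ⊙-isCommutativeMonoid

ΠRL : ∀ {i c ℓ} (I : Set i) (A : I → ResiduatedLattice c ℓ) → ResiduatedLattice (i ⊔ c) (i ⊔ ℓ)
ΠRL I A = record
  { Carrier = (j : I) → C j
  ; _≈_ = λ x y → ∀ j → R._≈_ j (x j) (y j)
  ; _∨_ = λ x y j → R._∨_ j (x j) (y j)
  ; _∧_ = λ x y j → R._∧_ j (x j) (y j)
  ; _⊙_ = λ x y j → R._⊙_ j (x j) (y j)
  ; _⇒_ = λ x y j → R._⇒_ j (x j) (y j)
  ; 0# = λ j → R.0# j
  ; 1# = λ j → R.1# j
  ; isLattice = record
    { isEquivalence = eqv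
    ; ∨-comm = λ x y j → L.∨-comm j (x j) (y j)
    ; ∨-assoc = λ x y z j → L.∨-assoc j (x j) (y j) (z j)
    ; ∨-cong = λ p q j → L.∨-cong j (p j) (q j)
    ; ∧-comm = λ x y j → L.∧-comm j (x j) (y j)
    ; ∧-assoc = λ x y z j → L.∧-assoc j (x j) (y j) (z j)
    ; ∧-cong = λ p q j → L.∧-cong j (p j) (q j)
    ; absorptive = (λ x y j → proj₁ (L.absorptive j) (x j) (y j))
                 , (λ x y j → proj₂ (L.absorptive j) (x j) (y j))
    }
  ; ⊙-isCommutativeMonoid = record
    { isMonoid = record
      { isSemigroup = record
        { isMagma = record
          { isEquivalence = eqv
          ; ∙-cong = λ p q j → M.∙-cong j (p j) (q j) }
        ; assoc = λ x y z j → M.assoc j (x j) (y j) (z j) }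
      ; identity = (λ x j → proj₁ (M.identity j) (x j)) , (λ x j → proj₂ (M.identity j) (x j)) }
    ; comm = λ x y j → M.comm j (x j) (y j) }
  ; ⇒-cong = λ p q j → R.⇒-cong j (p j) (q j)
  ; 0-least = λ a j → R.0-least j (a j)
  ; 1-greatest = λ a j → R.1-greatest j (a j)
  ; residuation-→ = λ a b c p j → R.residuation-→ j (a j) (b j) (c j) (p j)
  ; residuation-← = λ a b c p j → R.residuation-← j (a j) (b j) (c j) (p j)
  }
  where
  module R (j : I) = ResiduatedLattice (A j)
  module L (j : I) = IsLattice (R.isLattice j)
  module M (j : I) = IsCommutativeMonoid (R.⊙-isCommutativeMonoid j)
  C : I → Set _
  C j = R.Carrier j
  eqv = record { refl = λ j → L.refl j ; sym = λ p j → L.sym j (p j) ; trans = λ p q j → L.trans j (p j) (q j) }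

-- For any filter F, the class a/F is dense in A/F iff ¬¬a ∈ F, since 0 → ¬a = 1.
-- If a ≡_F d with d dense, then d → a ≤ ¬a → ¬d = ¬¬a puts ¬¬a in F; conversely,
-- if ¬¬a ∈ F ⊆ Ds(A) then ¬a ≤ ¬¬¬a = 0, so a itself is a dense representative.
-- Parts (ii) and (iii) hold because ¬ and 0 of a subalgebra or a product are
-- computed in A, respectively componentwise.
module Submission where

open import Defs
open import Level using (Level)
open import Data.Product using (_×_; _,_; proj₁; proj₂)
open import Relation.Unary using (Pred; _∈_)
open import Function.Base using (id)
open import Function.Bundles using (_⇔_; mk⇔; Equivalence)
open import Algebra.Lattice.Bundles using (Lattice)
import Algebra.Lattice.Properties.Lattice as LatticeProperties
open import Algebra.Structures using (IsCommutativeMonoid)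
open import Relation.Binary.Lattice.Bundles using (MeetSemilattice)

module ResiduatedLatticeProperties {c ℓ : Level} (A : ResiduatedLattice c ℓ) where

  open ResiduatedLattice A
  open IsCommutativeMonoid ⊙-isCommutativeMonoid
    using (refl; sym; trans; assoc; comm; identityˡ; ∙-congˡ)

  lattice : Lattice c ℓ
  lattice = record { isLattice = isLattice }

  -- The stdlib natural order is  x ≈ x ∧ y,  the symmetric form of _≤_.
  private
    module N = MeetSemilattice (LatticeProperties.∧-orderTheoreticMeetSemilattice lattice)

  ≤-refl : ∀ {a} → a ≤ a
  ≤-refl = sym N.refl

  ≤-trans : ∀ {a b d} → a ≤ b → b ≤ d → a ≤ d
  ≤-trans p q = sym (N.trans (sym p) (sym q))

  ≤-antisym : ∀ {a b} → a ≤ b → b ≤ a → a ≈ b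
  ≤-antisym p q = N.antisym (sym p) (sym q)

  ≤-respˡ-≈ : ∀ {a a′ b} → a ≈ a′ → a ≤ b → a′ ≤ b
  ≤-respˡ-≈ e p = sym (proj₂ N.≤-resp-≈ e (sym p))

  ≤-respʳ-≈ : ∀ {a b b′} → b ≈ b′ → a ≤ b → a ≤ b′
  ≤-respʳ-≈ e p = sym (proj₁ N.≤-resp-≈ e (sym p))

  x∧y≤x : ∀ a b → (a ∧ b) ≤ a
  x∧y≤x a b = sym (N.x∧y≤x a b)

  x∧y≤y : ∀ a b → (a ∧ b) ≤ b
  x∧y≤y a b = sym (N.x∧y≤y a b)

  ∧-greatest : ∀ {a b d} → d ≤ a → d ≤ b → d ≤ (a ∧ b)
  ∧-greatest p q = sym (N.∧-greatest (sym p) (sym q))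

  ⊙-≤-⇒ : ∀ {a b d} → a ≤ (b ⇒ d) → (a ⊙ b) ≤ d
  ⊙-≤-⇒ = residuation-→ _ _ _

  ⇒-≤-⊙ : ∀ {a b d} → (a ⊙ b) ≤ d → a ≤ (b ⇒ d)
  ⇒-≤-⊙ = residuation-← _ _ _

  ⊙-monoˡ-≤ : ∀ {a b} d → a ≤ b → (a ⊙ d) ≤ (b ⊙ d)
  ⊙-monoˡ-≤ d p = ⊙-≤-⇒ (≤-trans p (⇒-≤-⊙ ≤-refl))

  ⇒-eval : ∀ a b → ((a ⇒ b) ⊙ a) ≤ b
  ⇒-eval a b = ⊙-≤-⇒ ≤-refl

  ⇒-evalʳ : ∀ a b → (a ⊙ (a ⇒ b)) ≤ b
  ⇒-evalʳ a b = ≤-respˡ-≈ (comm (a ⇒ b) a) (⇒-eval a b)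

  1≤x⇒x : ∀ a → 1# ≤ (a ⇒ a)
  1≤x⇒x a = ⇒-≤-⊙ (≤-respˡ-≈ (sym (identityˡ a)) ≤-refl)

  1≤0⇒x : ∀ a → 1# ≤ (0# ⇒ a)
  1≤0⇒x a = ⇒-≤-⊙ (≤-respˡ-≈ (sym (identityˡ 0#)) (0-least a))

  x≤¬¬x : ∀ a → a ≤ (¬ (¬ a))
  x≤¬¬x a = ⇒-≤-⊙ (⇒-evalʳ a 0#)

  ⇒-contra : ∀ a b → (a ⇒ b) ≤ (¬ b ⇒ ¬ a)
  ⇒-contra a b = ⇒-≤-⊙ (⇒-≤-⊙ (≤-trans (≤-respˡ-≈ swap (⊙-monoˡ-≤ (¬ b) (⇒-eval a b)))
                                       (⇒-evalʳ b 0#)))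
    where
    swap : (((a ⇒ b) ⊙ a) ⊙ ¬ b) ≈ (((a ⇒ b) ⊙ ¬ b) ⊙ a)
    swap = trans (assoc _ _ _) (trans (∙-congˡ (comm a (¬ b))) (sym (assoc _ _ _)))

  dense-¬¬⇒dense : ∀ {a} → ¬ (¬ a) ∈ Ds A → a ∈ Ds A
  dense-¬¬⇒dense {a} d = ≤-antisym (≤-respʳ-≈ d (x≤¬¬x (¬ a))) (0-least (¬ a))

  module _ {f} {F : Pred Carrier f} (isFilter : IsFilter A F) where

    open IsFilter isFilter

    infix 4 _≡F_
    _≡F_ : Carrier → Carrier → Set f
    a ≡F b = _≡[_]_ {A = A} a F b

    1∈F : 1# ∈ F
    1∈F = up-closed (proj₂ nonempty) (1-greatest _)

    ≡F-refl : ∀ a → a ≡F a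
    ≡F-refl a = up-closed 1∈F (∧-greatest (1≤x⇒x a) (1≤x⇒x a))

    DsQuot⇔¬¬∈ : ∀ a → a ∈ DsQuot A F ⇔ ¬ (¬ a) ∈ F
    DsQuot⇔¬¬∈ a = mk⇔
      (λ p → up-closed p (x∧y≤x _ _))
      (λ p → up-closed p (∧-greatest ≤-refl (≤-trans (1-greatest _) (1≤0⇒x (¬ a)))))

    ≡F-dense⇒¬¬∈ : ∀ {a d} → a ≡F d → d ∈ Ds A → ¬ (¬ a) ∈ F
    ≡F-dense⇒¬¬∈ {a} {d} a≡d dense =
      up-closed (up-closed a≡d (x∧y≤y _ _)) (≤-respʳ-≈ (⇒-cong refl dense) (⇒-contra d a))

    Ds-quotient : (∀ a → a ∈ F → a ∈ Ds A) → ∀ a → a ∈ DsQuot A F ⇔ a ∈ DsModF A F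
    Ds-quotient F⊆Ds a = mk⇔
      (λ p → a , dense-¬¬⇒dense (F⊆Ds _ (Equivalence.to (DsQuot⇔¬¬∈ a) p)) , ≡F-refl a)
      (λ { (d , dense , a≡d) → Equivalence.from (DsQuot⇔¬¬∈ a) (≡F-dense⇒¬¬∈ a≡d dense) })

Ds-subalgebra : ∀ {c ℓ b} (A : ResiduatedLattice c ℓ) (B : Pred (ResiduatedLattice.Carrier A) b)
                (S : IsSubalgebra A B) (x : ResiduatedLattice.Carrier (SubRL A B S)) →
                x ∈ Ds (SubRL A B S) ⇔ proj₁ x ∈ Ds A
Ds-subalgebra A B S x = mk⇔ id id

Ds-product : ∀ {i c ℓ} (I : Set i) (As : I → ResiduatedLattice c ℓ)
             (x : ResiduatedLattice.Carrier (ΠRL I As)) →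
             x ∈ Ds (ΠRL I As) ⇔ (∀ j → x j ∈ Ds (As j))
Ds-product I As x = mk⇔ id id

proposition4p2 : ∀ {c ℓ f b i c′ ℓ′ : Level} (A : ResiduatedLattice c ℓ) →
    (∀ (F : Pred (ResiduatedLattice.Carrier A) f) → IsFilter A F →
      (∀ a → a ∈ F → a ∈ Ds A) →
      ∀ x → (x ∈ DsQuot A F) ⇔ (x ∈ DsModF A F))
    ×
    (∀ (B : Pred (ResiduatedLattice.Carrier A) b) (S : IsSubalgebra A B) →
      ∀ (x : ResiduatedLattice.Carrier (SubRL A B S)) →
      (x ∈ Ds (SubRL A B S)) ⇔ (proj₁ x ∈ Ds A))
    ×
    (∀ (I : Set i) (As : I → ResiduatedLattice c′ ℓ′) →
      ∀ (x : ResiduatedLattice.Carrier (ΠRL I As)) →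
      (x ∈ Ds (ΠRL I As)) ⇔ (∀ j → x j ∈ Ds (As j)))
proposition4p2 A =
  (λ F isFilter → ResiduatedLatticeProperties.Ds-quotient A isFilter) ,
  Ds-subalgebra A ,
  Ds-product
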